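{- For the cycle $C_n$ on $n\ge 3$ vertices, $DC(C_n)=3$.
   Context: Let $G=(V,E)$ be a finite simple undirected graph, $N[v]=\{v\}\cup N(v)$. A set $D\subseteq V$ is a double dominating set if $|N[v]\cap D|\ge 2$ for every $v\in V$. Two disjoint sets $V_1,V_2\subseteq V$ form a double coalition if neither is a double dominating set but $V_1\cup V_2$ is. A double coalition partition ($dc$-partition) of $G$ is a partition $\Pi$ of $V$ such that every set of $\Pi$ is not a double dominating set and forms a double coalition with some other set of $\Pi$. The double coalition number $DC(G)$ is the maximum cardinality of a $dc$-partition of $G$. -}

module Defs where

open import Data.Nat using (ℕ; zero; suc; _+_; _≤_; _≥_; NonZero)
open import Data.Nat.DivMod using (_%_)
open import Data.Fin using (Fin; toℕ)
open import Data.Product using (Σ; ∃; _×_; _,_)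
open import Data.Sum using (_⊎_)
open import Relation.Nullary using (¬_)
open import Relation.Binary.PropositionalEquality using (_≡_; _≢_)
open import Level using (0ℓ)
open import Data.Nat using (_<_; s≤s; z≤n)
open import Data.Nat.Properties using (m<n⇒m≤1+n; 1+n≢n; ≤-antisym; <⇒≤; suc-injective)
open import Data.Nat.DivMod using (m<n⇒m%n≡m; n%n≡0)
open import Data.Fin.Properties using (toℕ<n)
open import Data.Fin.Properties using (toℕ-injective)
open import Data.Sum using (inj₁; inj₂)
open import Data.Empty using (⊥; ⊥-elim)
open import Relation.Binary.PropositionalEquality using (refl; trans; subst; cong) renaming (sym to ≡-sym)
open import Data.Nat using (_≤?_)
open import Relation.Nullary using (yes; no)
open import Data.Nat.Properties using (≰⇒>)

record Graph (n : ℕ) : Set₁ where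
  field
    Adj     : Fin n → Fin n → Set
    irrefl  : ∀ v → ¬ Adj v v
    sym     : ∀ u v → Adj u v → Adj v u
open Graph public

VSet : ℕ → Set₁
VSet n = Fin n → Set

InClosedNbhd : ∀ {n} → Graph n → Fin n → Fin n → Set
InClosedNbhd G v u = (u ≡ v) ⊎ Adj G v u

IsDoubleDominating : ∀ {n} → Graph n → VSet n → Set
IsDoubleDominating G D =
  ∀ v → Σ _ λ u → Σ _ λ w →
    u ≢ w × InClosedNbhd G v u × D u × InClosedNbhd G v w × D w

-- A partition of V into k sets: a labelling f : V → Fin k, with
-- every block V_i = f⁻¹(i) nonempty (sets of a partition are nonempty).
record Partition {n : ℕ} (G : Graph n) (k : ℕ) : Set where
  field
    label    : Fin n → Fin k
    nonempty : ∀ i → ∃ λ v → label v ≡ i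
open Partition public

Block : ∀ {n k} {G : Graph n} → Partition G k → Fin k → VSet n
Block P i v = label P v ≡ i

Union : ∀ {n} → VSet n → VSet n → VSet n
Union A B v = A v ⊎ B v

DoubleCoalition : ∀ {n k} (G : Graph n) → Partition G k → Fin k → Fin k → Set
DoubleCoalition G P i j =
  ¬ IsDoubleDominating G (Block P i) ×
  ¬ IsDoubleDominating G (Block P j) ×
  IsDoubleDominating G (Union (Block P i) (Block P j))

IsDCPartition : ∀ {n k} (G : Graph n) → Partition G k → Set
IsDCPartition {k = k} G P =
  (∀ i → ¬ IsDoubleDominating G (Block P i)) ×
  (∀ i → Σ (Fin k) λ j → i ≢ j × DoubleCoalition G P i j)

HasDCNumber : ∀ {n} → Graph n → ℕ → Set
HasDCNumber G m =
  (Σ (Partition G m) λ P → IsDCPartition G P) ×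
  (∀ k (P : Partition G k) → IsDCPartition G P → k ≤ m)

CycleAdj : (n : ℕ) → .{{NonZero n}} → Fin n → Fin n → Set
CycleAdj n {{nz}} i j = (toℕ j ≡ (suc (toℕ i)) % n) ⊎ (toℕ i ≡ (suc (toℕ j)) % n)

private
  cyc-irr : (m : ℕ) → (suc m ≥ 3) → (i : Fin (suc m)) →
            ¬ (toℕ i ≡ (suc (toℕ i)) % suc m)
  cyc-irr m n≥3 i eq with suc (toℕ i) ≤? m
  ... | yes lt = 1+n≢n (≡-sym (trans eq (m<n⇒m%n≡m (s≤s lt))))
  ... | no nlt = bad (toℕ i) z e n≥3
    where
      e : suc (toℕ i) ≡ suc m
      e = ≤-antisym (toℕ<n i) (≰⇒> nlt)
      z : toℕ i ≡ 0
      z = trans eq (trans (cong (_% suc m) e) (n%n≡0 (suc m)))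
      bad : (x : ℕ) → x ≡ 0 → suc x ≡ suc m → suc m ≥ 3 → ⊥
      bad .0 refl refl (s≤s ())

Cycle : (n : ℕ) → n ≥ 3 → Graph n
Cycle (suc m) n≥3 = record
  { Adj    = CycleAdj (suc m)
  ; irrefl = λ { v (inj₁ e) → cyc-irr m n≥3 v e ; v (inj₂ e) → cyc-irr m n≥3 v e }
  ; sym    = λ { u v (inj₁ e) → inj₂ e ; u v (inj₂ e) → inj₁ e }
  }

-- Let a dc-partition of a graph of maximum degree ≤ 2 have k ≥ 4 sets, and let f send
-- each set to a partner with which it forms a double coalition.  A closed neighbourhood
-- N[v] has at most three vertices, so a label absent from N[v₀] has a partner x that
-- labels two vertices of N[v₀]; then f i = x for every i ≠ x, since i and f i need two
-- further places in N[v₀].  Hence x labels two vertices of every N[v]: if x occurs in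
-- N[v], a label absent from N[v] has partner x; if not, any two labels other than x
-- would both label two vertices of N[v].  So the set labelled x is double dominating.
-- For C_n the partition {0}, {1}, {2, …, n − 1} attains 3, as all vertices but one
-- always form a double dominating set.

module Submission where

open import Defs
open import Data.Nat using (ℕ; zero; suc; _+_; _≤_; _<_; _≥_; s≤s; s≤s⁻¹; z≤n; _≤?_)
open import Data.Nat.Properties using (≤-refl; ≤-trans; ≤-antisym; ≰⇒>; +-mono-≤; +-identityʳ; +-suc; suc-injective; m≢1+n+m; module ≤-Reasoning)
open import Data.Nat.DivMod using (_%_; m%n<n; m<n⇒m%n≡m; n%n≡0)
open import Data.Fin using (Fin; toℕ; fromℕ<; fromℕ; inject₁) renaming (zero to fz; suc to fs)
open import Data.Fin.Properties using (_≟_; toℕ-fromℕ<; toℕ-fromℕ; toℕ-inject₁; toℕ<n; toℕ-injective; pigeonhole; ¬∀⟶∃¬; <⇒≢)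
open import Data.List using (List; []; _∷_; length; filter; map; lookup)
open import Data.List.Properties using (length-filter; filter-none; length-map)
import Data.List.Relation.Unary.All as All
open import Data.List.Relation.Unary.Any using (here; there; index)
open import Data.List.Relation.Unary.Any.Properties using (lookup-index)
open import Data.List.Relation.Unary.Unique.Propositional using (Unique; []; _∷_)
open import Data.List.Relation.Unary.Unique.Propositional.Properties using (filter⁺)
open import Data.List.Membership.Propositional using (_∈_; _∉_)
open import Data.List.Membership.Propositional.Properties using (∈-filter⁺; ∈-filter⁻; ∈-map⁺)
import Data.List.Membership.DecPropositional as DecMembership
open import Data.Product using (∃; ∃₂; _×_; _,_; proj₁; proj₂)
open import Data.Sum using (_⊎_; inj₁; inj₂; swap)
open import Data.Empty using (⊥-elim)
open import Relation.Nullary using (¬_; yes; no; contradiction)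
open import Relation.Unary using (Pred; Decidable; _∪_; _⊥_)
open import Relation.Unary.Properties using (_∪?_)
open import Relation.Binary.PropositionalEquality using (_≡_; _≢_; refl; trans; cong; subst; ≢-sym) renaming (sym to ≡-sym)
open import Relation.Binary.PropositionalEquality using (module ≡-Reasoning)

count : ∀ {a p} {A : Set a} {P : Pred A p} → Decidable P → List A → ℕ
count P? xs = length (filter P? xs)

module _ {a p q} {A : Set a} {P : Pred A p} {Q : Pred A q}
         (P? : Decidable P) (Q? : Decidable Q) (P⊥Q : P ⊥ Q) where

  count-∪ : ∀ xs → count (P? ∪? Q?) xs ≡ count P? xs + count Q? xs
  count-∪ [] = refl
  count-∪ (x ∷ xs) with P? x | Q? x
  ... | yes px | yes qx = ⊥-elim (P⊥Q (px , qx))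
  ... | yes _  | no _   = cong suc (count-∪ xs)
  ... | no _   | yes _  = trans (cong suc (count-∪ xs)) (≡-sym (+-suc (count P? xs) (count Q? xs)))
  ... | no _   | no _   = count-∪ xs

  count-∪-≤-length : ∀ xs → count P? xs + count Q? xs ≤ length xs
  count-∪-≤-length xs = subst (_≤ length xs) (count-∪ xs) (length-filter (P? ∪? Q?) xs)

distinct∈⇒2≤length : ∀ {a} {A : Set a} {u w : A} {ys : List A} →
                     u ≢ w → u ∈ ys → w ∈ ys → 2 ≤ length ys
distinct∈⇒2≤length {ys = _ ∷ _ ∷ _} _ _ _ = s≤s (s≤s z≤n)
distinct∈⇒2≤length {ys = _ ∷ []} u≢w (here refl) (here refl) = contradiction refl u≢w
distinct∈⇒2≤length {ys = _ ∷ []} _ (there ()) _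
distinct∈⇒2≤length {ys = _ ∷ []} _ _ (there ())

2≤length⇒distinct∈ : ∀ {a} {A : Set a} {ys : List A} →
                     Unique ys → 2 ≤ length ys → ∃₂ λ u w → u ≢ w × u ∈ ys × w ∈ ys
2≤length⇒distinct∈ ((u≢w All.∷ _) ∷ _) (s≤s (s≤s _)) = _ , _ , u≢w , here refl , there (here refl)

length<⇒∃∉ : ∀ {K} (xs : List (Fin K)) → length xs < K → ∃ λ z → z ∉ xs
length<⇒∃∉ {K} xs |xs|<K = ¬∀⟶∃¬ K (_∈ xs) (_∈? xs) not-all-listed
  where
  open DecMembership (_≟_ {K}) using (_∈?_)
  not-all-listed : ¬ (∀ z → z ∈ xs)
  not-all-listed z∈xs with i , j , i<j , same-index ← pigeonhole |xs|<K (λ z → index (z∈xs z)) =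
    <⇒≢ i<j (begin
      i                           ≡⟨ lookup-index (z∈xs i) ⟩
      lookup xs (index (z∈xs i))  ≡⟨ cong (lookup xs) same-index ⟩
      lookup xs (index (z∈xs j))  ≡⟨ ≡-sym (lookup-index (z∈xs j)) ⟩
      j                           ∎)
    where open ≡-Reasoning

record ClosedNbhdListing {n} (G : Graph n) : Set where
  field
    nbhd     : Fin n → List (Fin n)
    sound    : ∀ {v u} → u ∈ nbhd v → InClosedNbhd G v u
    complete : ∀ {v u} → InClosedNbhd G v u → u ∈ nbhd v
    unique   : ∀ v → Unique (nbhd v)

block? : ∀ {n k} {G : Graph n} (P : Partition G k) i → Decidable (Block P i)
block? P i u = label P u ≟ i

module _ {n} {G : Graph n} (L : ClosedNbhdListing G) {D : VSet n} (D? : Decidable D) where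
  open ClosedNbhdListing L

  double-dominating⇒count : IsDoubleDominating G D → ∀ v → 2 ≤ count D? (nbhd v)
  double-dominating⇒count dd v with u , w , u≢w , u∈N[v] , Du , w∈N[v] , Dw ← dd v =
    distinct∈⇒2≤length u≢w (∈-filter⁺ D? (complete u∈N[v]) Du) (∈-filter⁺ D? (complete w∈N[v]) Dw)

  count⇒double-dominating : (∀ v → 2 ≤ count D? (nbhd v)) → IsDoubleDominating G D
  count⇒double-dominating 2≤count v
    with u , w , u≢w , u∈ , w∈ ← 2≤length⇒distinct∈ (filter⁺ D? (unique v)) (2≤count v)
    with u∈N[v] , Du ← ∈-filter⁻ D? u∈ | w∈N[v] , Dw ← ∈-filter⁻ D? w∈ =
    u , w , u≢w , sound u∈N[v] , Du , sound w∈N[v] , Dw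

-- Graphs of maximum degree at most two

module _ {n} {G : Graph n} (L : ClosedNbhdListing G)
         (nbhd≤3 : ∀ v → length (ClosedNbhdListing.nbhd L v) ≤ 3) where
  open ClosedNbhdListing L

  module BlockCounts {k} (P : Partition G k) where

    # : Fin k → Fin n → ℕ
    # i v = count (block? P i) (nbhd v)

    block-⊥ : ∀ {i j} → i ≢ j → Block P i ⊥ Block P j
    block-⊥ i≢j (u∈i , u∈j) = i≢j (trans (≡-sym u∈i) u∈j)

    block-⊥-∪ : ∀ {x i j} → x ≢ i → x ≢ j → Block P x ⊥ (Block P i ∪ Block P j)
    block-⊥-∪ x≢i _ (u∈x , inj₁ u∈i) = block-⊥ x≢i (u∈x , u∈i)
    block-⊥-∪ _ x≢j (u∈x , inj₂ u∈j) = block-⊥ x≢j (u∈x , u∈j)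

    absent⇒#≡0 : ∀ {z v} → z ∉ map (label P) (nbhd v) → # z v ≡ 0
    absent⇒#≡0 {z} {v} z∉ = cong length (filter-none (block? P z) (All.tabulate not-z))
      where
      not-z : ∀ {u} → u ∈ nbhd v → label P u ≢ z
      not-z u∈ refl = z∉ (∈-map⁺ (label P) u∈)

    some-label-absent : 3 < k → ∀ v → ∃ λ z → z ∉ map (label P) (nbhd v)
    some-label-absent 3<k v = length<⇒∃∉ _
      (subst (_< k) (≡-sym (length-map (label P) (nbhd v))) (≤-trans (s≤s (nbhd≤3 v)) 3<k))

  module Partners {k} (P : Partition G k) (f : Fin k → Fin k) (f-irrefl : ∀ i → i ≢ f i)
    (covers : ∀ i v → 2 ≤ count (block? P i ∪? block? P (f i)) (nbhd v)) where
    open BlockCounts P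
    open DecMembership (_≟_ {k}) using (_∈?_)

    #-partners : ∀ i v → count (block? P i ∪? block? P (f i)) (nbhd v) ≡ # i v + # (f i) v
    #-partners i v = count-∪ (block? P i) (block? P (f i)) (block-⊥ (f-irrefl i)) (nbhd v)

    partner-dominates : ∀ {z v} → # z v ≡ 0 → 2 ≤ # (f z) v
    partner-dominates {z} {v} #z≡0 =
      subst (2 ≤_) (trans (#-partners z v) (cong (_+ # (f z) v) #z≡0)) (covers z v)

    dominates-partner : ∀ {z v} → # (f z) v ≡ 0 → 2 ≤ # z v
    dominates-partner {z} {v} #fz≡0 =
      subst (2 ≤_) (trans (#-partners z v) (trans (cong (# z v +_) #fz≡0) (+-identityʳ (# z v))))
        (covers z v)

    partner-of-dominant : ∀ {y i v} → 2 ≤ # y v → i ≢ y → f i ≡ y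
    partner-of-dominant {y} {i} {v} 2≤#y i≢y with f i ≟ y
    ... | yes fi≡y = fi≡y
    ... | no fi≢y = ⊥-elim (¬4≤3 (begin
      4                                                     ≤⟨ +-mono-≤ 2≤#y (covers i v) ⟩
      # y v + count (block? P i ∪? block? P (f i)) (nbhd v) ≤⟨ count-∪-≤-length (block? P y) _ y⊥i∪fi (nbhd v) ⟩
      length (nbhd v)                                       ≤⟨ nbhd≤3 v ⟩
      3                                                     ∎))
      where
      open ≤-Reasoning
      y⊥i∪fi : Block P y ⊥ (Block P i ∪ Block P (f i))
      y⊥i∪fi = block-⊥-∪ (≢-sym i≢y) (≢-sym fi≢y)
      ¬4≤3 : ¬ 4 ≤ 3
      ¬4≤3 (s≤s (s≤s (s≤s ())))

    common-partner : 3 < k → ∃ λ x → ∀ {i} → i ≢ x → f i ≡ x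
    common-partner 3<k with z , z∉ ← some-label-absent 3<k (proj₁ (nonempty P (fromℕ< 3<k))) =
      f z , partner-of-dominant (partner-dominates (absent⇒#≡0 z∉))

    common-partner-dominates : 3 < k → ∀ {x} → (∀ {i} → i ≢ x → f i ≡ x) → ∀ v → 2 ≤ # x v
    common-partner-dominates 3<k {x} partner-x v with x ∈? map (label P) (nbhd v)
    ... | yes x∈ with z , z∉ ← some-label-absent 3<k v =
      subst (λ y → 2 ≤ # y v) (partner-x z≢x) (partner-dominates (absent⇒#≡0 z∉))
      where
      z≢x : z ≢ x
      z≢x refl = z∉ x∈
    ... | no x∉
      with z , z∉[x] ← length<⇒∃∉ (x ∷ []) (≤-trans (s≤s (s≤s z≤n)) 3<k)
      with w , w∉[x,z] ← length<⇒∃∉ (x ∷ z ∷ []) (≤-trans (s≤s (s≤s (s≤s z≤n))) 3<k) =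
      contradiction (trans (≡-sym (partner-of-dominant z-dominates w≢z)) (partner-x w≢x)) z≢x
      where
      z≢x : z ≢ x
      z≢x z≡x = z∉[x] (here z≡x)
      w≢x : w ≢ x
      w≢x w≡x = w∉[x,z] (here w≡x)
      w≢z : w ≢ z
      w≢z w≡z = w∉[x,z] (there (here w≡z))
      z-dominates : 2 ≤ # z v
      z-dominates = dominates-partner (subst (λ y → # y v ≡ 0) (≡-sym (partner-x z≢x)) (absent⇒#≡0 x∉))

    dominant-label : 3 < k → ∃ λ x → ∀ v → 2 ≤ # x v
    dominant-label 3<k with x , partner-x ← common-partner 3<k =
      x , common-partner-dominates 3<k partner-x

  dc-partition-size≤3 : ∀ k (P : Partition G k) → IsDCPartition G P → k ≤ 3
  dc-partition-size≤3 k P (not-dd , coalition) with k ≤? 3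
  ... | yes k≤3 = k≤3
  ... | no k≰3 = contradiction (count⇒double-dominating L (block? P x) x-dominates) (not-dd x)
    where
    open BlockCounts P
    partner : Fin k → Fin k
    partner i = proj₁ (coalition i)
    open Partners P partner (λ i → proj₁ (proj₂ (coalition i)))
      (λ i → double-dominating⇒count L _ (proj₂ (proj₂ (proj₂ (proj₂ (coalition i))))))

    x : Fin k
    x = proj₁ (dominant-label (≰⇒> k≰3))
    x-dominates : ∀ v → 2 ≤ # x v
    x-dominates = proj₂ (dominant-label (≰⇒> k≰3))

-- Cycles

module CycleStructure (m : ℕ) (3≤n : suc (suc (suc m)) ≥ 3) where
  open ≡-Reasoning

  M : ℕ
  M = suc (suc m)

  G : Graph (suc M)
  G = Cycle (suc M) 3≤n

  nxt : Fin (suc M) → Fin (suc M)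
  nxt i = fromℕ< (m%n<n (suc (toℕ i)) (suc M))

  toℕ-nxt : ∀ i → toℕ (nxt i) ≡ suc (toℕ i) % suc M
  toℕ-nxt i = toℕ-fromℕ< (m%n<n (suc (toℕ i)) (suc M))

  prv : Fin (suc M) → Fin (suc M)
  prv fz     = fromℕ M
  prv (fs j) = inject₁ j

  nxt-prv : ∀ v → nxt (prv v) ≡ v
  nxt-prv fz = toℕ-injective (begin
    toℕ (nxt (fromℕ M))         ≡⟨ toℕ-nxt (fromℕ M) ⟩
    suc (toℕ (fromℕ M)) % suc M ≡⟨ cong (λ y → suc y % suc M) (toℕ-fromℕ M) ⟩
    suc M % suc M               ≡⟨ n%n≡0 (suc M) ⟩
    0                           ∎)
  nxt-prv (fs j) = toℕ-injective (begin
    toℕ (nxt (inject₁ j))         ≡⟨ toℕ-nxt (inject₁ j) ⟩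
    suc (toℕ (inject₁ j)) % suc M ≡⟨ cong (λ y → suc y % suc M) (toℕ-inject₁ j) ⟩
    suc (toℕ j) % suc M           ≡⟨ m<n⇒m%n≡m (s≤s (toℕ<n j)) ⟩
    suc (toℕ j)                   ∎)

  toℕ-nxt-cases : ∀ u → toℕ (nxt u) ≡ suc (toℕ u) ⊎ (toℕ u ≡ M × toℕ (nxt u) ≡ 0)
  toℕ-nxt-cases u with suc (toℕ u) ≤? M
  ... | yes 1+u≤M = inj₁ (trans (toℕ-nxt u) (m<n⇒m%n≡m (s≤s 1+u≤M)))
  ... | no 1+u≰M  =
    inj₂ (u≡M , trans (toℕ-nxt u) (trans (cong (λ y → suc y % suc M) u≡M) (n%n≡0 (suc M))))
    where
    u≡M : toℕ u ≡ M
    u≡M = ≤-antisym (s≤s⁻¹ (toℕ<n u)) (s≤s⁻¹ (≰⇒> 1+u≰M))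

  toℕ-prv-suc : ∀ w {y} → toℕ w ≡ suc y → toℕ (prv w) ≡ y
  toℕ-prv-suc (fs j) w≡1+y = trans (toℕ-inject₁ j) (suc-injective w≡1+y)

  toℕ-prv-zero : ∀ w → toℕ w ≡ 0 → toℕ (prv w) ≡ M
  toℕ-prv-zero fz _ = toℕ-fromℕ M

  prv-nxt : ∀ u → prv (nxt u) ≡ u
  prv-nxt u with toℕ-nxt-cases u
  ... | inj₁ nxt≡1+u       = toℕ-injective (toℕ-prv-suc (nxt u) nxt≡1+u)
  ... | inj₂ (u≡M , nxt≡0) = toℕ-injective (trans (toℕ-prv-zero (nxt u) nxt≡0) (≡-sym u≡M))

  adj-nxt : ∀ v → Adj G v (nxt v)
  adj-nxt v = inj₁ (toℕ-nxt v)

  adj-prv : ∀ v → Adj G v (prv v)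
  adj-prv v = inj₂ (trans (cong toℕ (≡-sym (nxt-prv v))) (toℕ-nxt (prv v)))

  adj⇒nxt⊎prv : ∀ {v u} → Adj G v u → u ≡ nxt v ⊎ u ≡ prv v
  adj⇒nxt⊎prv {v} {u} (inj₁ u≡1+v) = inj₁ (toℕ-injective (trans u≡1+v (≡-sym (toℕ-nxt v))))
  adj⇒nxt⊎prv {v} {u} (inj₂ v≡1+u) =
    inj₂ (trans (≡-sym (prv-nxt u)) (cong prv (toℕ-injective (trans (toℕ-nxt u) (≡-sym v≡1+u)))))

  prv≢self : ∀ v → prv v ≢ v
  prv≢self v prv≡v = irrefl G v (subst (Adj G v) prv≡v (adj-prv v))

  self≢nxt : ∀ v → v ≢ nxt v
  self≢nxt v v≡nxt = irrefl G v (subst (Adj G v) (≡-sym v≡nxt) (adj-nxt v))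

  -- This is where n ≥ 3 is needed.
  prv≢nxt : ∀ v → prv v ≢ nxt v
  prv≢nxt fz ()
  prv≢nxt (fs j) prv≡nxt
    with toℕ-nxt-cases (fs j) | trans (≡-sym (toℕ-inject₁ j)) (cong toℕ prv≡nxt)
  ... | inj₁ nxt≡2+j         | j≡nxt = m≢1+n+m (toℕ j) (trans j≡nxt nxt≡2+j)
  ... | inj₂ (1+j≡M , nxt≡0) | j≡nxt =
    contradiction (trans (≡-sym (suc-injective 1+j≡M)) (trans j≡nxt nxt≡0)) λ ()

  listing : ClosedNbhdListing G
  listing = record
    { nbhd     = λ v → prv v ∷ v ∷ nxt v ∷ []
    ; sound    = sound
    ; complete = complete
    ; unique   = λ v → (prv≢self v All.∷ prv≢nxt v All.∷ All.[]) ∷ (self≢nxt v All.∷ All.[]) ∷ All.[] ∷ []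
    }
    where
    sound : ∀ {v u} → u ∈ prv v ∷ v ∷ nxt v ∷ [] → InClosedNbhd G v u
    sound {v} (here refl)                 = inj₂ (adj-prv v)
    sound     (there (here refl))         = inj₁ refl
    sound {v} (there (there (here refl))) = inj₂ (adj-nxt v)

    complete : ∀ {v u} → InClosedNbhd G v u → u ∈ prv v ∷ v ∷ nxt v ∷ []
    complete (inj₁ refl) = there (here refl)
    complete (inj₂ adj) with adj⇒nxt⊎prv adj
    ... | inj₁ u≡nxt = there (there (here u≡nxt))
    ... | inj₂ u≡prv = here u≡prv

  all-but-one⇒double-dominating : ∀ {D : VSet (suc M)} t → (∀ u → u ≢ t → D u) →
                                  IsDoubleDominating G D
  all-but-one⇒double-dominating t D⊇V∖t v with v ≟ t | prv v ≟ t
  ... | yes refl | _ =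
    prv v , nxt v , prv≢nxt v , inj₂ (adj-prv v) , D⊇V∖t _ (prv≢self v) ,
    inj₂ (adj-nxt v) , D⊇V∖t _ (≢-sym (self≢nxt v))
  ... | no v≢t | yes refl =
    v , nxt v , self≢nxt v , inj₁ refl , D⊇V∖t _ v≢t , inj₂ (adj-nxt v) , D⊇V∖t _ (≢-sym (prv≢nxt v))
  ... | no v≢t | no prv≢t =
    prv v , v , prv≢self v , inj₂ (adj-prv v) , D⊇V∖t _ prv≢t , inj₁ refl , D⊇V∖t _ v≢t

  three-blocks : Fin (suc M) → Fin 3
  three-blocks fz          = fz
  three-blocks (fs fz)     = fs fz
  three-blocks (fs (fs _)) = fs (fs fz)

  P₃ : Partition G 3
  P₃ = record
    { label    = three-blocks
    ; nonempty = λ { fz → fz , refl ; (fs fz) → fs fz , refl ; (fs (fs fz)) → fs (fs fz) , refl }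
    }

  -- N[0] = {M, 0, 1} meets each block in exactly one vertex.
  P₃-block-not-dd : ∀ i → ¬ IsDoubleDominating G (Block P₃ i)
  P₃-block-not-dd i dd = ¬2≤count i (double-dominating⇒count listing (block? P₃ i) dd fz)
    where
    ¬2≤count : ∀ i → ¬ 2 ≤ count (block? P₃ i) (prv fz ∷ fz ∷ nxt fz ∷ [])
    ¬2≤count fz           (s≤s ())
    ¬2≤count (fs fz)      (s≤s ())
    ¬2≤count (fs (fs fz)) (s≤s ())

  V∖1⊆B₀∪B₂ : ∀ u → u ≢ fs fz → Union (Block P₃ fz) (Block P₃ (fs (fs fz))) u
  V∖1⊆B₀∪B₂ fz          _   = inj₁ refl
  V∖1⊆B₀∪B₂ (fs fz)     u≢1 = contradiction refl u≢1
  V∖1⊆B₀∪B₂ (fs (fs _)) _   = inj₂ refl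

  V∖0⊆B₁∪B₂ : ∀ u → u ≢ fz → Union (Block P₃ (fs fz)) (Block P₃ (fs (fs fz))) u
  V∖0⊆B₁∪B₂ fz          u≢0 = contradiction refl u≢0
  V∖0⊆B₁∪B₂ (fs fz)     _   = inj₁ refl
  V∖0⊆B₁∪B₂ (fs (fs _)) _   = inj₂ refl

  P₃-dc : IsDCPartition G P₃
  P₃-dc = P₃-block-not-dd , coalition
    where
    coalition : ∀ i → ∃ λ j → i ≢ j × DoubleCoalition G P₃ i j
    coalition fz           = fs (fs fz) , (λ ()) , P₃-block-not-dd _ , P₃-block-not-dd _ ,
                             all-but-one⇒double-dominating (fs fz) V∖1⊆B₀∪B₂
    coalition (fs fz)      = fs (fs fz) , (λ ()) , P₃-block-not-dd _ , P₃-block-not-dd _ ,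
                             all-but-one⇒double-dominating fz V∖0⊆B₁∪B₂
    coalition (fs (fs fz)) = fz , (λ ()) , P₃-block-not-dd _ , P₃-block-not-dd _ ,
                             all-but-one⇒double-dominating (fs fz) (λ u u≢1 → swap (V∖1⊆B₀∪B₂ u u≢1))

mainTheorem9 : (n : ℕ) → (n≥3 : n ≥ 3) → HasDCNumber (Cycle n n≥3) 3
mainTheorem9 (suc zero)          (s≤s ())
mainTheorem9 (suc (suc zero))    (s≤s (s≤s ()))
mainTheorem9 (suc (suc (suc m))) 3≤n =
  (P₃ , P₃-dc) , dc-partition-size≤3 listing (λ _ → ≤-refl)
  where open CycleStructure m 3≤n
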